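{- Let $\mathcal{A} \subset \omega^\omega$ be a MAD family and let $\mathcal{I}_0(\mathcal{A}) = \{a \subset \omega : \exists p \in \omega^a\ \forall h \in \mathcal{A}\ [|p \cap h| < \omega]\}$. Let $\mathcal{E} = \{E \in [\omega\times\omega]^\omega : \forall k \in \omega\ \exists a \subset \mathrm{dom}(E)\ [a \notin \mathcal{I}_0(\mathcal{A}) \wedge \forall n \in a\ |E(n)| > k]\}$. Then $\mathcal{I} = \mathcal{P}(\omega\times\omega) \setminus \mathcal{E}$ is an ideal on $\omega \times \omega$.
   Context: Functions (including partial functions $p\in\omega^a$, $a\subset\omega$) are identified with their graphs (subsets of $\omega\times\omega$). An a.d. family $\mathcal{A}\subset\omega^\omega$ is one with $|f\cap g|<\omega$ for distinct $f,g\in\mathcal{A}$; it is a MAD family in $\omega^\omega$ if moreover every $f\in\omega^\omega$ satisfies $|f\cap h|=\omega$ for some $h\in\mathcal{A}$. For $E\subset\omega\times\omega$, $E(n)=\{m\in\omega:\langle n,m\rangle\in E\}$ and $\mathrm{dom}(E)=\{n\in\omega: E(n)\neq\emptyset\}$. -}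

module Defs where

open import Level using (Level; 0ℓ) renaming (suc to lsuc)
open import Data.Nat using (ℕ; suc; _<_)
open import Data.Fin using (Fin)
open import Data.Product using (Σ; ∃; _×_; _,_)
open import Data.Sum using (_⊎_)
open import Data.Empty using (⊥)
open import Data.Unit using (⊤)
open import Relation.Nullary using (¬_)
open import Relation.Binary.PropositionalEquality using (_≡_)
open import Function.Definitions using (Injective)

Subset : Set₁
Subset = ℕ → Set

Rel2 : Set₁
Rel2 = ℕ → ℕ → Set

Family : Set₁
Family = (ℕ → ℕ) → Set

FiniteSet : Subset → Set
FiniteSet a = ∃ λ N → ∀ n → a n → n < N

InfiniteSet : Subset → Set
InfiniteSet a = ¬ FiniteSet a

Finite2 : Rel2 → Set
Finite2 E = ∃ λ N → ∀ n m → E n m → (n < N) × (m < N)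

Infinite2 : Rel2 → Set
Infinite2 E = ¬ Finite2 E

-- |f ∩ g| for total functions: the set of agreement points.
agree : (ℕ → ℕ) → (ℕ → ℕ) → Subset
agree f g n = f n ≡ g n

IsAD : Family → Set
IsAD 𝒜 = ∀ f g → 𝒜 f → 𝒜 g → ¬ (∀ n → f n ≡ g n) → FiniteSet (agree f g)

IsMAD : Family → Set
IsMAD 𝒜 = IsAD 𝒜 × (∀ f → Σ (ℕ → ℕ) λ h → 𝒜 h × InfiniteSet (agree f h))

-- A partial function p ∈ ω^a is represented by a total p : ℕ → ℕ
-- whose graph is restricted to a: p ∩ h = {n ∈ a : p n = h n}.
agreeOn : Subset → (ℕ → ℕ) → (ℕ → ℕ) → Subset
agreeOn a p h n = a n × (p n ≡ h n)

I₀ : Family → Subset → Set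
I₀ 𝒜 a = Σ (ℕ → ℕ) λ p → ∀ h → 𝒜 h → FiniteSet (agreeOn a p h)

section : Rel2 → ℕ → Subset
section E n m = E n m

dom : Rel2 → Subset
dom E n = ∃ λ m → E n m

CardGt : Subset → ℕ → Set
CardGt S k = Σ (Fin (suc k) → ℕ) λ f → Injective _≡_ _≡_ f × (∀ i → S (f i))

_⊆₁_ : Subset → Subset → Set
a ⊆₁ b = ∀ n → a n → b n

𝓔 : Family → Rel2 → Set₁
𝓔 𝒜 E = Infinite2 E ×
  (∀ k → Σ Subset λ a → (a ⊆₁ dom E) × (¬ I₀ 𝒜 a) × (∀ n → a n → CardGt (section E n) k))

𝓘 : Family → Rel2 → Set₁
𝓘 𝒜 X = ¬ 𝓔 𝒜 X

_⊆₂_ : Rel2 → Rel2 → Set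
X ⊆₂ Y = ∀ n m → X n m → Y n m

_∪₂_ : Rel2 → Rel2 → Rel2
(X ∪₂ Y) n m = X n m ⊎ Y n m

record IsIdeal (I : Rel2 → Set₁) : Set₂ where
  field
    finite∈  : ∀ X → Finite2 X → I X
    down     : ∀ X Y → X ⊆₂ Y → I Y → I X
    union    : ∀ X Y → I X → I Y → I (X ∪₂ Y)
    proper   : ¬ I (λ _ _ → ⊤)

-- Call X large at level k if some a ⊆ dom X outside I₀(𝒜) has |X(n)| > k for every
-- n ∈ a. Then X ∈ 𝓔 iff X is large at every level, since that already forces X to be
-- infinite; classically, X ∈ 𝓘 iff X fails to be large at some level. If X fails at i
-- and Y at j, then X ∪ Y fails at i + j: whenever |(X ∪ Y)(n)| > i + j, either
-- |X(n)| > i or |Y(n)| > j, which covers any candidate a by two sets in I₀(𝒜), and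
-- I₀(𝒜) is closed under subsets and finite unions. Maximality of 𝒜 keeps ω out of
-- I₀(𝒜), which makes the ideal proper.
module Submission where

open import Defs
open import Level using (0ℓ)
open import Axiom.ExcludedMiddle using (ExcludedMiddle)
open import Axiom.DoubleNegationElimination using (em⇒dne)
open import Data.Nat using (ℕ; zero; suc; _+_; _≤_; _<_; s≤s)
open import Data.Nat.Properties
  using ( ≤-trans; ≮⇒≥; +-suc; +-monoˡ-≤; +-cancelˡ-≤; m≤m+n; m≤n+m; n<1+n; <-irrefl
        ; module ≤-Reasoning)
open import Data.Fin using (Fin; zero; suc; toℕ; fromℕ<)
open import Data.Fin.Properties using (toℕ-injective; toℕ-fromℕ<; pigeonhole; <⇒≢)
open import Data.Product using (Σ; ∃; _×_; _,_; proj₁; proj₂)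
open import Data.Sum using (inj₁; inj₂)
open import Data.Unit using (⊤; tt)
open import Data.List using (List; []; _∷_; length; filter; tabulate)
open import Data.List.Properties using (length-tabulate)
open import Data.List.Relation.Unary.All as All using (All; _∷_)
open import Data.List.Relation.Unary.All.Properties using (all-filter; filter⁺; tabulate⁺)
open import Data.List.Relation.Unary.AllPairs using (_∷_)
open import Data.List.Relation.Unary.Unique.Propositional using (Unique)
import Data.List.Relation.Unary.Unique.Propositional.Properties as Unique
open import Relation.Nullary using (¬_; yes; no; contradiction)
open import Relation.Unary using (Decidable; U; _∪_; _∩_)
open import Relation.Unary.Properties using (∁?)
open import Relation.Binary.PropositionalEquality
  using (_≡_; refl; sym; trans; cong; module ≡-Reasoning)
open import Function.Definitions using (Injective)

private
  variable
    𝒜 : Family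
    X Y : Rel2
    S T a b : Subset
    k : ℕ

CardGt-mono : S ⊆₁ T → CardGt S k → CardGt T k
CardGt-mono S⊆T (f , f-inj , f∈S) = f , f-inj , λ i → S⊆T _ (f∈S i)

CardGt-U : ∀ k → CardGt U k
CardGt-U k = toℕ , toℕ-injective , λ _ → tt

bounded⇒¬CardGt : ∀ N → (∀ m → S m → m < N) → ¬ CardGt S N
bounded⇒¬CardGt N bound (f , f-inj , f∈S)
  with i , j , i<j , gi≡gj ← pigeonhole (n<1+n N) (λ i → fromℕ< (bound (f i) (f∈S i)))
  = <⇒≢ i<j (f-inj (begin
      f i                                     ≡⟨ sym (toℕ-fromℕ< _) ⟩
      toℕ (fromℕ< (bound (f i) (f∈S i)))     ≡⟨ cong toℕ gi≡gj ⟩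
      toℕ (fromℕ< (bound (f j) (f∈S j)))     ≡⟨ toℕ-fromℕ< _ ⟩
      f j                                     ∎))
  where
  open ≡-Reasoning

CardGt⇒dom : ∀ {n} → CardGt (section X n) k → dom X n
CardGt⇒dom (f , _ , f∈S) = f zero , f∈S zero

Unique⇒CardGt : ∀ k (xs : List ℕ) → Unique xs → All S xs → suc k ≤ length xs →
                CardGt S k
Unique⇒CardGt zero (x ∷ _) _ (x∈S ∷ _) _ =
  (λ _ → x) , (λ { {zero} {zero} _ → refl }) , λ _ → x∈S
Unique⇒CardGt {S = S} (suc k) (x ∷ xs) (x∉xs ∷ xs-unique) (x∈S ∷ xs⊆S) (s≤s k<∣xs∣)
  with g , g-inj , g∈S ← Unique⇒CardGt k xs xs-unique (All.zip (x∉xs , xs⊆S)) k<∣xs∣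
  = f , f-inj , f∈S
  where
  f : Fin (suc (suc k)) → ℕ
  f zero    = x
  f (suc i) = g i
  f-inj : Injective _≡_ _≡_ f
  f-inj {zero}  {zero}  _ = refl
  f-inj {zero}  {suc j} e = contradiction e (proj₁ (g∈S j))
  f-inj {suc i} {zero}  e = contradiction (sym e) (proj₁ (g∈S i))
  f-inj {suc i} {suc j} e = cong suc (g-inj e)
  f∈S : ∀ i → S (f i)
  f∈S zero    = x∈S
  f∈S (suc i) = proj₂ (g∈S i)

length-filter-∁ : {A : Set} {P : A → Set} (P? : Decidable P) (xs : List A) →
                  length (filter P? xs) + length (filter (∁? P?) xs) ≡ length xs
length-filter-∁ P? [] = refl
length-filter-∁ P? (x ∷ xs) with P? x
... | yes _ = cong suc (length-filter-∁ P? xs)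
... | no  _ = trans (+-suc _ _) (cong suc (length-filter-∁ P? xs))

CardGt-∪ : ExcludedMiddle 0ℓ → ∀ i j →
           CardGt (S ∪ T) (i + j) → ¬ CardGt S i → CardGt T j
CardGt-∪ {S} {T} em i j (f , f-inj , f∈S∪T) ¬S>i =
  Unique⇒CardGt j zs (Unique.filter⁺ (∁? S?) xs-unique) zs⊆T j<∣zs∣
  where
  S? : Decidable S
  S? _ = em
  xs = tabulate f
  xs-unique : Unique xs
  xs-unique = Unique.tabulate⁺ f-inj
  ys = filter S? xs
  zs = filter (∁? S?) xs
  xs⊆S∪T : All (S ∪ T) xs
  xs⊆S∪T = tabulate⁺ f∈S∪T
  zs⊆T : All T zs
  zs⊆T = All.zipWith (λ { (inj₁ s , ¬s) → contradiction s ¬s ; (inj₂ t , _) → t })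
                     (filter⁺ (∁? S?) xs⊆S∪T , all-filter (∁? S?) xs)
  ∣ys∣≤i : length ys ≤ i
  ∣ys∣≤i = ≮⇒≥ λ i<∣ys∣ →
    ¬S>i (Unique⇒CardGt i ys (Unique.filter⁺ S? xs-unique) (all-filter S? xs) i<∣ys∣)
  j<∣zs∣ : suc j ≤ length zs
  j<∣zs∣ = +-cancelˡ-≤ i (suc j) (length zs) (begin
    i + suc j             ≡⟨ +-suc i j ⟩
    suc (i + j)           ≡⟨ sym (length-tabulate f) ⟩
    length xs             ≡⟨ sym (length-filter-∁ S? xs) ⟩
    length ys + length zs ≤⟨ +-monoˡ-≤ (length zs) ∣ys∣≤i ⟩
    i + length zs         ∎)
    where open ≤-Reasoning

I₀-⊆ : a ⊆₁ b → I₀ 𝒜 b → I₀ 𝒜 a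
I₀-⊆ a⊆b (p , p-fin) = p , λ h h∈𝒜 →
  let N , bound = p-fin h h∈𝒜 in N , λ n (n∈a , e) → bound n (a⊆b n n∈a , e)

I₀-∪ : ExcludedMiddle 0ℓ → I₀ 𝒜 a → I₀ 𝒜 b → I₀ 𝒜 (a ∪ b)
I₀-∪ {𝒜} {a} {b} em (p , p-fin) (q , q-fin) = r , r-fin
  where
  r : ℕ → ℕ
  r n with em {a n}
  ... | yes _ = p n
  ... | no  _ = q n
  r-fin : ∀ h → 𝒜 h → FiniteSet (agreeOn (a ∪ b) r h)
  r-fin h h∈𝒜 = Na + Nb , bound
    where
    Na = proj₁ (p-fin h h∈𝒜)
    Nb = proj₁ (q-fin h h∈𝒜)
    bound : ∀ n → agreeOn (a ∪ b) r h n → n < Na + Nb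
    bound n (n∈a∪b , e) with em {a n} | n∈a∪b
    ... | yes n∈a | _        = ≤-trans (proj₂ (p-fin h h∈𝒜) n (n∈a , e)) (m≤m+n Na Nb)
    ... | no  n∉a | inj₁ n∈a = contradiction n∈a n∉a
    ... | no  _   | inj₂ n∈b = ≤-trans (proj₂ (q-fin h h∈𝒜) n (n∈b , e)) (m≤n+m Nb Na)

MAD⇒U∉I₀ : IsMAD 𝒜 → ¬ I₀ 𝒜 U
MAD⇒U∉I₀ (_ , maximal) (p , p-fin) =
  let h , h∈𝒜 , p∩h-infinite = maximal p
      N , bound = p-fin h h∈𝒜
  in p∩h-infinite (N , λ n e → bound n (tt , e))

Large : Family → Rel2 → ℕ → Set₁
Large 𝒜 E k =
  Σ Subset λ a → (a ⊆₁ dom E) × (¬ I₀ 𝒜 a) × (∀ n → a n → CardGt (section E n) k)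

Large-mono : X ⊆₂ Y → Large 𝒜 X k → Large 𝒜 Y k
Large-mono X⊆Y (a , a⊆dom , a∉I₀ , big) =
  a , (λ n n∈a → let m , x = a⊆dom n n∈a in m , X⊆Y n m x) , a∉I₀ ,
  λ n n∈a → CardGt-mono (X⊆Y n) (big n n∈a)

¬Large⇒I₀ : ExcludedMiddle 0ℓ → ¬ Large 𝒜 X k →
            (∀ n → a n → CardGt (section X n) k) → I₀ 𝒜 a
¬Large⇒I₀ {X = X} em ¬large big =
  em⇒dne em λ a∉I₀ → ¬large (_ , (λ n n∈a → CardGt⇒dom {X} (big n n∈a)) , a∉I₀ , big)

Finite2⇒¬Large : (fin : Finite2 X) → ¬ Large 𝒜 X (proj₁ fin)
Finite2⇒¬Large (N , bound) (_ , _ , a∉I₀ , big) =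
  a∉I₀ ((λ _ → 0) , λ _ _ → 0 , λ n (n∈a , _) →
    contradiction (big n n∈a) (bounded⇒¬CardGt N λ m x → proj₂ (bound n m x)))

𝓘⇒¬Large : ExcludedMiddle (Level.suc 0ℓ) → 𝓘 𝒜 X → ∃ λ k → ¬ Large 𝒜 X k
𝓘⇒¬Large em X∉𝓔 = em⇒dne em λ all-large →
  let large k = em⇒dne em λ ¬large → all-large (k , ¬large)
  in X∉𝓔 ((λ fin → Finite2⇒¬Large fin (large (proj₁ fin))) , large)

𝓘-⊆ : X ⊆₂ Y → 𝓘 𝒜 Y → 𝓘 𝒜 X
𝓘-⊆ X⊆Y Y∉𝓔 (X-infinite , X-large) =
  Y∉𝓔 ((λ (N , bound) → X-infinite (N , λ n m x → bound n m (X⊆Y n m x))) ,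
       λ k → Large-mono X⊆Y (X-large k))

¬Large-∪ : ExcludedMiddle 0ℓ → ∀ i j →
           ¬ Large 𝒜 X i → ¬ Large 𝒜 Y j → ¬ Large 𝒜 (X ∪₂ Y) (i + j)
¬Large-∪ {X = X} {Y} em i j ¬LX ¬LY (a , _ , a∉I₀ , big) =
  a∉I₀ (I₀-⊆ a⊆aX∪aY (I₀-∪ em (¬Large⇒I₀ em ¬LX λ _ → proj₂)
                               (¬Large⇒I₀ em ¬LY λ _ → proj₂)))
  where
  a⊆aX∪aY : a ⊆₁ ((a ∩ λ n → CardGt (X n) i) ∪ (a ∩ λ n → CardGt (Y n) j))
  a⊆aX∪aY n n∈a with em {CardGt (X n) i}
  ... | yes X>i = inj₁ (n∈a , X>i)
  ... | no  X≯i = inj₂ (n∈a , CardGt-∪ {S = X n} {T = Y n} em i j (big n n∈a) X≯i)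

𝓘-∪ : ExcludedMiddle 0ℓ → ExcludedMiddle (Level.suc 0ℓ) →
      𝓘 𝒜 X → 𝓘 𝒜 Y → 𝓘 𝒜 (X ∪₂ Y)
𝓘-∪ em₀ em₁ X∈𝓘 Y∈𝓘 (_ , large) =
  let i , ¬LX = 𝓘⇒¬Large em₁ X∈𝓘
      j , ¬LY = 𝓘⇒¬Large em₁ Y∈𝓘
  in ¬Large-∪ em₀ i j ¬LX ¬LY (large (i + j))

lemma10 : ExcludedMiddle 0ℓ → ExcludedMiddle (Level.suc 0ℓ) →
    (𝒜 : Family) → IsMAD 𝒜 → IsIdeal (𝓘 𝒜)
lemma10 em₀ em₁ 𝒜 mad = record
  { finite∈ = λ _ fin (infinite , _) → infinite fin
  ; down    = λ _ _ → 𝓘-⊆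
  ; union   = λ _ _ → 𝓘-∪ em₀ em₁
  ; proper  = λ full∉𝓔 → full∉𝓔 (full-infinite , full-large)
  }
  where
  full-infinite : Infinite2 (λ _ _ → ⊤)
  full-infinite (N , bound) = <-irrefl refl (proj₁ (bound N 0 tt))
  full-large : ∀ k → Large 𝒜 (λ _ _ → ⊤) k
  full-large k = U , (λ _ _ → 0 , tt) , MAD⇒U∉I₀ mad , λ _ _ → CardGt-U k
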